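{- Let $U:\mathcal{E}\to\mathcal{B}$ be a bifibration and let $\alpha:F\to G$ be a natural transformation between functors $F,G:\mathcal{A}\to\mathcal{B}$. Then there is an adjunction $\Sigma_\alpha\dashv\alpha^*$ between $F^*\mathcal{E}$ and $G^*\mathcal{E}$, with $\Sigma_\alpha:F^*\mathcal{E}\to G^*\mathcal{E}$ and $\alpha^*:G^*\mathcal{E}\to F^*\mathcal{E}$ commuting with the projections $F^*U$ and $G^*U$ to $\mathcal{A}$, given on objects by $\Sigma_\alpha(X,P)=(X,\Sigma_{\alpha_X}P)$ and $\alpha^*(X,Q)=(X,(\alpha_X)^*Q)$. Furthermore, if $U$ satisfies the Beck-Chevalley condition and the components of $\alpha$ are monos, then $\Sigma_\alpha$ is full and faithful.
   Context: A bifibration is a functor $U$ that is both a fibration (cartesian liftings exist, giving reindexing functors $f^*:\mathcal{E}_Y\to\mathcal{E}_X$ between fibres) and an opfibration (opcartesian liftings exist, giving opreindexing functors $\Sigma_f:\mathcal{E}_X\to\mathcal{E}_Y$, left adjoint to $f^*$). For a functor $H:\mathcal{A}\to\mathcal{B}$, the change of base $H^*\mathcal{E}$ is the pullback category whose objects are pairs $(X,P)$ with $X$ in $\mathcal{A}$, $P$ in $\mathcal{E}$, $HX=UP$, and morphisms pairs $(h,g)$ with $Hh=Ug$; $H^*U:H^*\mathcal{E}\to\mathcal{A}$ is the projection $(X,P)\mapsto X$. $U$ satisfies the Beck-Chevalley condition if for every pullback square $ft=gs$ in $\mathcal{B}$ the canonical natural transformation $\Sigma_s t^*\to g^*\Sigma_f$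 (built from the unit of $\Sigma_f\dashv f^*$ and the counit of $\Sigma_s\dashv s^*$) is an isomorphism. -}

module Defs where

open import Level using (Level; _⊔_; suc)
open import Data.Product using (Σ; Σ-syntax; _×_; _,_; proj₁; proj₂)
open import Relation.Binary.PropositionalEquality using (_≡_; refl; sym; trans; cong)
open import Relation.Binary.Structures using (IsEquivalence)
open import Relation.Binary.Bundles using (Setoid)
import Relation.Binary.Reasoning.Setoid as SetoidR

record Category (o ℓ e : Level) : Set (suc (o ⊔ ℓ ⊔ e)) where
  infix  4 _≈_
  infixr 9 _∘_
  field
    Obj       : Set o
    _⇒_       : Obj → Obj → Set ℓ
    _≈_       : ∀ {A B} → A ⇒ B → A ⇒ B → Set e
    id        : ∀ {A} → A ⇒ A
    _∘_       : ∀ {A B C} → B ⇒ C → A ⇒ B → A ⇒ C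
    assoc     : ∀ {A B C D} {f : A ⇒ B} {g : B ⇒ C} {h : C ⇒ D} →
                (h ∘ g) ∘ f ≈ h ∘ (g ∘ f)
    identityˡ : ∀ {A B} {f : A ⇒ B} → id ∘ f ≈ f
    identityʳ : ∀ {A B} {f : A ⇒ B} → f ∘ id ≈ f
    equiv     : ∀ {A B} → IsEquivalence (_≈_ {A} {B})
    ∘-resp-≈  : ∀ {A B C} {f h : B ⇒ C} {g i : A ⇒ B} →
                f ≈ h → g ≈ i → f ∘ g ≈ h ∘ i

  hom-setoid : Obj → Obj → Setoid ℓ e
  hom-setoid A B = record { Carrier = A ⇒ B ; _≈_ = _≈_ ; isEquivalence = equiv }

  idₑ : ∀ {A B} → A ≡ B → A ⇒ B
  idₑ refl = id

  Mono : ∀ {A B} → A ⇒ B → Set (o ⊔ ℓ ⊔ e)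
  Mono {A} f = ∀ {Z} (u v : Z ⇒ A) → f ∘ u ≈ f ∘ v → u ≈ v

  IsIso : ∀ {A B} → A ⇒ B → Set (ℓ ⊔ e)
  IsIso {A} {B} f = Σ[ g ∈ B ⇒ A ] ((g ∘ f ≈ id) × (f ∘ g ≈ id))

open Category

record Functor {o ℓ e o′ ℓ′ e′} (C : Category o ℓ e) (D : Category o′ ℓ′ e′)
       : Set (o ⊔ ℓ ⊔ e ⊔ o′ ⊔ ℓ′ ⊔ e′) where
  field
    F₀           : Obj C → Obj D
    F₁           : ∀ {A B} → _⇒_ C A B → _⇒_ D (F₀ A) (F₀ B)
    identity     : ∀ {A} → _≈_ D (F₁ (id C {A})) (id D)
    homomorphism : ∀ {X Y Z} {f : _⇒_ C X Y} {g : _⇒_ C Y Z} →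
                   _≈_ D (F₁ (_∘_ C g f)) (_∘_ D (F₁ g) (F₁ f))
    F-resp-≈     : ∀ {A B} {f g : _⇒_ C A B} → _≈_ C f g → _≈_ D (F₁ f) (F₁ g)

open Functor

record NatTrans {o ℓ e o′ ℓ′ e′} {C : Category o ℓ e} {D : Category o′ ℓ′ e′}
       (F G : Functor C D) : Set (o ⊔ ℓ ⊔ e ⊔ ℓ′ ⊔ e′) where
  field
    η       : ∀ X → _⇒_ D (F₀ F X) (F₀ G X)
    commute : ∀ {X Y} (f : _⇒_ C X Y) →
              _≈_ D (_∘_ D (η Y) (F₁ F f)) (_∘_ D (F₁ G f) (η X))

open NatTrans

record Adjunction {o ℓ e o′ ℓ′ e′} {C : Category o ℓ e} {D : Category o′ ℓ′ e′}
       (L : Functor C D) (R : Functor D C) : Set (o ⊔ ℓ ⊔ e ⊔ o′ ⊔ ℓ′ ⊔ e′) where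
  field
    unit           : ∀ A → _⇒_ C A (F₀ R (F₀ L A))
    counit         : ∀ B → _⇒_ D (F₀ L (F₀ R B)) B
    unit-natural   : ∀ {A A′} (f : _⇒_ C A A′) →
                     _≈_ C (_∘_ C (F₁ R (F₁ L f)) (unit A)) (_∘_ C (unit A′) f)
    counit-natural : ∀ {B B′} (g : _⇒_ D B B′) →
                     _≈_ D (_∘_ D g (counit B)) (_∘_ D (counit B′) (F₁ L (F₁ R g)))
    zig            : ∀ A → _≈_ D (_∘_ D (counit (F₀ L A)) (F₁ L (unit A))) (id D)
    zag            : ∀ B → _≈_ C (_∘_ C (F₁ R (counit B)) (unit (F₀ R B))) (id C)

record FullyFaithful {o ℓ e o′ ℓ′ e′} {C : Category o ℓ e} {D : Category o′ ℓ′ e′}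
       (F : Functor C D) : Set (o ⊔ ℓ ⊔ e ⊔ ℓ′ ⊔ e′) where
  field
    full     : ∀ {A B} (k : _⇒_ D (F₀ F A) (F₀ F B)) →
               Σ[ f ∈ _⇒_ C A B ] _≈_ D (F₁ F f) k
    faithful : ∀ {A B} (f g : _⇒_ C A B) → _≈_ D (F₁ F f) (F₁ F g) → _≈_ C f g

module _ {oe ℓe ee ob ℓb eb} {E : Category oe ℓe ee} {B : Category ob ℓb eb}
         (U : Functor E B) where

  private
    module E = Category E
    module B = Category B
    module U = Functor U

  IsCartesian : ∀ {P Q} → P E.⇒ Q → Set (oe ⊔ ℓe ⊔ ee ⊔ ℓb ⊔ eb)
  IsCartesian {P} {Q} φ =
    ∀ {R} (g : R E.⇒ Q) (h : U.F₀ R B.⇒ U.F₀ P) → U.F₁ g B.≈ U.F₁ φ B.∘ h →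
    Σ[ k ∈ R E.⇒ P ] ((U.F₁ k B.≈ h) × (φ E.∘ k E.≈ g) ×
      (∀ (k′ : R E.⇒ P) → U.F₁ k′ B.≈ h → φ E.∘ k′ E.≈ g → k′ E.≈ k))

  IsOpcartesian : ∀ {P Q} → P E.⇒ Q → Set (oe ⊔ ℓe ⊔ ee ⊔ ℓb ⊔ eb)
  IsOpcartesian {P} {Q} ψ =
    ∀ {R} (g : P E.⇒ R) (h : U.F₀ Q B.⇒ U.F₀ R) → U.F₁ g B.≈ h B.∘ U.F₁ ψ →
    Σ[ k ∈ Q E.⇒ R ] ((U.F₁ k B.≈ h) × (k E.∘ ψ E.≈ g) ×
      (∀ (k′ : Q E.⇒ R) → U.F₁ k′ B.≈ h → k′ E.∘ ψ E.≈ g → k′ E.≈ k))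

  record CartLift {X : B.Obj} {Q : E.Obj} (f : X B.⇒ U.F₀ Q)
         : Set (oe ⊔ ℓe ⊔ ee ⊔ ob ⊔ ℓb ⊔ eb) where
    field
      dom  : E.Obj
      eq   : U.F₀ dom ≡ X
      arr  : dom E.⇒ Q
      over : U.F₁ arr B.≈ f B.∘ B.idₑ eq
      cart : IsCartesian arr

  record OpcartLift {P : E.Obj} {Y : B.Obj} (f : U.F₀ P B.⇒ Y)
         : Set (oe ⊔ ℓe ⊔ ee ⊔ ob ⊔ ℓb ⊔ eb) where
    field
      cod    : E.Obj
      eq     : U.F₀ cod ≡ Y
      arr    : P E.⇒ cod
      over   : B.idₑ eq B.∘ U.F₁ arr B.≈ f
      opcart : IsOpcartesian arr

  record Bifibration : Set (oe ⊔ ℓe ⊔ ee ⊔ ob ⊔ ℓb ⊔ eb) where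
    field
      cartLift   : ∀ {X Q} (f : X B.⇒ U.F₀ Q) → CartLift f
      opcartLift : ∀ {P Y} (f : U.F₀ P B.⇒ Y) → OpcartLift f

  record IsPullback {W X Y Z : B.Obj} (f : Y B.⇒ Z) (g : X B.⇒ Z)
         (t : W B.⇒ Y) (s : W B.⇒ X) : Set (ob ⊔ ℓb ⊔ eb) where
    field
      commute   : f B.∘ t B.≈ g B.∘ s
      universal : ∀ {V} (a : V B.⇒ Y) (b : V B.⇒ X) → f B.∘ a B.≈ g B.∘ b →
                  Σ[ u ∈ V B.⇒ W ] ((t B.∘ u B.≈ a) × (s B.∘ u B.≈ b) ×
                    (∀ (u′ : V B.⇒ W) → t B.∘ u′ B.≈ a → s B.∘ u′ B.≈ b → u′ B.≈ u))

  -- Beck-Chevalley: for every pullback square f t = g s and every Q in the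
  -- fibre over Y, the canonical comparison Σ_s t^* Q → g^* Σ_f Q is an iso.
  -- The canonical comparison is the unique vertical k with
  --   (cartesian g-lift) ∘ k ∘ (opcartesian s-lift) = (opcartesian f-lift) ∘ (cartesian t-lift),
  -- i.e. the mate built from the unit of Σ_f ⊣ f^* and the counit of Σ_s ⊣ s^*.
  BeckChevalley : Bifibration → Set (oe ⊔ ℓe ⊔ ee ⊔ ob ⊔ ℓb ⊔ eb)
  BeckChevalley bif =
    ∀ {W X Y Z} (f : Y B.⇒ Z) (g : X B.⇒ Z) (t : W B.⇒ Y) (s : W B.⇒ X) →
    IsPullback f g t s → ∀ (Q : E.Obj) (eQ : U.F₀ Q ≡ Y) →
    let ct = Bifibration.cartLift bif (B.idₑ (sym eQ) B.∘ t)
        os = Bifibration.opcartLift bif (s B.∘ B.idₑ (CartLift.eq ct))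
        of = Bifibration.opcartLift bif (f B.∘ B.idₑ eQ)
        cg = Bifibration.cartLift bif (B.idₑ (sym (OpcartLift.eq of)) B.∘ g)
    in Σ[ k ∈ OpcartLift.cod os E.⇒ CartLift.dom cg ]
         ((U.F₁ k B.≈ B.idₑ (trans (OpcartLift.eq os) (sym (CartLift.eq cg)))) ×
          (CartLift.arr cg E.∘ (k E.∘ OpcartLift.arr os)
             E.≈ OpcartLift.arr of E.∘ CartLift.arr ct) ×
          E.IsIso k)

module _ {oa ℓa ea oe ℓe ee ob ℓb eb}
         {A : Category oa ℓa ea} {E : Category oe ℓe ee} {B : Category ob ℓb eb}
         (U : Functor E B) (H : Functor A B) where

  private
    module A = Category A
    module E = Category E
    module B = Category B
    module U = Functor U
    module H = Functor H

  record CObj : Set (oa ⊔ oe ⊔ ob) where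
    constructor cobj
    field
      X : A.Obj
      P : E.Obj
      e : H.F₀ X ≡ U.F₀ P

  record CHom (o o′ : CObj) : Set (ℓa ⊔ ℓe ⊔ eb) where
    constructor chom
    private
      module o  = CObj o
      module o′ = CObj o′
    field
      h    : o.X A.⇒ o′.X
      g    : o.P E.⇒ o′.P
      comm : U.F₁ g B.∘ B.idₑ o.e B.≈ B.idₑ o′.e B.∘ H.F₁ h

  open CObj
  open CHom

  private
    module BR {x y} = SetoidR (B.hom-setoid x y)
    module Aeq {x y} = IsEquivalence (A.equiv {x} {y})
    module Eeq {x y} = IsEquivalence (E.equiv {x} {y})
    module Beq {x y} = IsEquivalence (B.equiv {x} {y})

    cid : ∀ {o} → CHom o o
    cid {o} = chom A.id E.id (begin
        U.F₁ E.id B.∘ B.idₑ (e o) ≈⟨ B.∘-resp-≈ U.identity Beq.refl ⟩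
        B.id B.∘ B.idₑ (e o)      ≈⟨ B.identityˡ ⟩
        B.idₑ (e o)               ≈⟨ Beq.sym B.identityʳ ⟩
        B.idₑ (e o) B.∘ B.id      ≈⟨ B.∘-resp-≈ Beq.refl (Beq.sym H.identity) ⟩
        B.idₑ (e o) B.∘ H.F₁ A.id ∎)
      where open BR

    ccomp : ∀ {o₁ o₂ o₃} → CHom o₂ o₃ → CHom o₁ o₂ → CHom o₁ o₃
    ccomp {o₁} {o₂} {o₃} (chom h₂ g₂ c₂) (chom h₁ g₁ c₁) =
      chom (h₂ A.∘ h₁) (g₂ E.∘ g₁) (begin
        U.F₁ (g₂ E.∘ g₁) B.∘ B.idₑ (e o₁)
          ≈⟨ B.∘-resp-≈ U.homomorphism Beq.refl ⟩
        (U.F₁ g₂ B.∘ U.F₁ g₁) B.∘ B.idₑ (e o₁)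
          ≈⟨ B.assoc ⟩
        U.F₁ g₂ B.∘ (U.F₁ g₁ B.∘ B.idₑ (e o₁))
          ≈⟨ B.∘-resp-≈ Beq.refl c₁ ⟩
        U.F₁ g₂ B.∘ (B.idₑ (e o₂) B.∘ H.F₁ h₁)
          ≈⟨ Beq.sym B.assoc ⟩
        (U.F₁ g₂ B.∘ B.idₑ (e o₂)) B.∘ H.F₁ h₁
          ≈⟨ B.∘-resp-≈ c₂ Beq.refl ⟩
        (B.idₑ (e o₃) B.∘ H.F₁ h₂) B.∘ H.F₁ h₁
          ≈⟨ B.assoc ⟩
        B.idₑ (e o₃) B.∘ (H.F₁ h₂ B.∘ H.F₁ h₁)
          ≈⟨ B.∘-resp-≈ Beq.refl (Beq.sym H.homomorphism) ⟩
        B.idₑ (e o₃) B.∘ H.F₁ (h₂ A.∘ h₁) ∎)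
      where open BR

  ChangeOfBase : Category (oa ⊔ oe ⊔ ob) (ℓa ⊔ ℓe ⊔ eb) (ea ⊔ ee)
  ChangeOfBase = record
    { Obj       = CObj
    ; _⇒_       = CHom
    ; _≈_       = λ m m′ → (h m A.≈ h m′) × (g m E.≈ g m′)
    ; id        = cid
    ; _∘_       = ccomp
    ; assoc     = A.assoc , E.assoc
    ; identityˡ = A.identityˡ , E.identityˡ
    ; identityʳ = A.identityʳ , E.identityʳ
    ; equiv     = record
      { refl  = Aeq.refl , Eeq.refl
      ; sym   = λ (p , q) → Aeq.sym p , Eeq.sym q
      ; trans = λ (p , q) (p′ , q′) → Aeq.trans p p′ , Eeq.trans q q′ }
    ; ∘-resp-≈  = λ (p , q) (p′ , q′) → A.∘-resp-≈ p p′ , E.∘-resp-≈ q q′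
    }

  projHom : ∀ {o o′} → CHom o o′ → CObj.X o A.⇒ CObj.X o′
  projHom = CHom.h

module _ {oa ℓa ea oe ℓe ee ob ℓb eb}
         {A : Category oa ℓa ea} {E : Category oe ℓe ee} {B : Category ob ℓb eb}
         (U : Functor E B) (bif : Bifibration U)
         {F G : Functor A B} (α : NatTrans F G) where

  private
    module A = Category A
    module B = Category B
    module U = Functor U
    module F = Functor F
    module G = Functor G
    module α = NatTrans α
    module bif = Bifibration bif

  ΣαObj : CObj U F → CObj U G
  ΣαObj (cobj X P e) =
    let l = bif.opcartLift {P} (α.η X B.∘ B.idₑ (sym e))
    in cobj X (OpcartLift.cod l) (sym (OpcartLift.eq l))

  α*Obj : CObj U G → CObj U F
  α*Obj (cobj X Q e) =
    let l = bif.cartLift {F.F₀ X} {Q} (B.idₑ e B.∘ α.η X)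
    in cobj X (CartLift.dom l) (sym (CartLift.eq l))

  record ΣαAdjunction : Set (oa ⊔ ℓa ⊔ ea ⊔ oe ⊔ ℓe ⊔ ee ⊔ ob ⊔ ℓb ⊔ eb) where
    field
      Σα     : Functor (ChangeOfBase U F) (ChangeOfBase U G)
      α*     : Functor (ChangeOfBase U G) (ChangeOfBase U F)
      Σα-obj : ∀ o → F₀ Σα o ≡ ΣαObj o
      α*-obj : ∀ o → F₀ α* o ≡ α*Obj o
      Σα-proj : ∀ {o o′} (m : CHom U F o o′) →
                A.idₑ (cong CObj.X (Σα-obj o′)) A.∘ CHom.h (F₁ Σα m)
                  A.≈ CHom.h m A.∘ A.idₑ (cong CObj.X (Σα-obj o))
      α*-proj : ∀ {o o′} (m : CHom U G o o′) →
                A.idₑ (cong CObj.X (α*-obj o′)) A.∘ CHom.h (F₁ α* m)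
                  A.≈ CHom.h m A.∘ A.idₑ (cong CObj.X (α*-obj o))
      adjunction : Adjunction Σα α*

-- The adjunction is fibrewise: Σ_{α_X} ⊣ (α_X)^* in each fibre, with the action on
-- morphisms obtained from the (op)cartesian universal properties and the naturality of α.
-- For full faithfulness it suffices that the unit is invertible. When α_X is mono, the square
-- α_X ∘ id = α_X ∘ id is a pullback, and Beck–Chevalley for it says that the comparison
-- Σ_id id^* P → (α_X)^* Σ_{α_X} P is invertible; since liftings of identities are
-- invertible, this comparison is the unit at (X , P) up to isomorphism.
module Submission where

open import Data.Product using (Σ; Σ-syntax; _×_; _,_; proj₁; proj₂)
open import Relation.Binary.PropositionalEquality using (_≡_; refl; sym)
open import Relation.Binary.Structures using (IsEquivalence)
import Relation.Binary.Reasoning.Setoid as SetoidReasoning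

open import Defs

module Properties {o ℓ e} (C : Category o ℓ e) where
  open Category C public

  module HomReasoning {A B} = SetoidReasoning (hom-setoid A B)
  open module Equiv {A B} = IsEquivalence (equiv {A} {B}) public
    using () renaming (refl to ≈-refl; sym to ≈-sym; trans to ≈-trans)

  private variable
    T V W X Y Z : Obj
    f g h i k x y : X ⇒ Y

  infixr 4 _⟩∘⟨_ refl⟩∘⟨_
  infixl 5 _⟩∘⟨refl

  _⟩∘⟨_ : f ≈ h → g ≈ i → f ∘ g ≈ h ∘ i
  _⟩∘⟨_ = ∘-resp-≈

  refl⟩∘⟨_ : g ≈ i → f ∘ g ≈ f ∘ i
  refl⟩∘⟨ p = ≈-refl ⟩∘⟨ p

  _⟩∘⟨refl : f ≈ h → f ∘ g ≈ h ∘ g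
  p ⟩∘⟨refl = p ⟩∘⟨ ≈-refl

  id-comm : f ∘ id ≈ id ∘ f
  id-comm = ≈-trans identityʳ (≈-sym identityˡ)

  id-comm-sym : id ∘ f ≈ f ∘ id
  id-comm-sym = ≈-sym id-comm

  glue : {f₁ : X ⇒ Y} {f₂ : Y ⇒ Z} {a : V ⇒ X} {b₁ : W ⇒ Y} {b₂ : T ⇒ Z}
         {g₁ : V ⇒ W} {g₂ : W ⇒ T} →
         f₂ ∘ b₁ ≈ b₂ ∘ g₂ → f₁ ∘ a ≈ b₁ ∘ g₁ → (f₂ ∘ f₁) ∘ a ≈ b₂ ∘ (g₂ ∘ g₁)
  glue {f₁ = f₁} {f₂} {a} {b₁} {b₂} {g₁} {g₂} sq₂ sq₁ = begin
    (f₂ ∘ f₁) ∘ a  ≈⟨ assoc ⟩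
    f₂ ∘ (f₁ ∘ a)  ≈⟨ refl⟩∘⟨ sq₁ ⟩
    f₂ ∘ (b₁ ∘ g₁) ≈⟨ ≈-sym assoc ⟩
    (f₂ ∘ b₁) ∘ g₁ ≈⟨ sq₂ ⟩∘⟨refl ⟩
    (b₂ ∘ g₂) ∘ g₁ ≈⟨ assoc ⟩
    b₂ ∘ (g₂ ∘ g₁) ∎
    where open HomReasoning

  inverse-square : {a : X ⇒ Y} {x : W ⇒ X} {y : Z ⇒ Y} {b : W ⇒ Z}
                   {a′ : Y ⇒ X} {b′ : Z ⇒ W} →
                   a ∘ x ≈ y ∘ b → a′ ∘ a ≈ id → b ∘ b′ ≈ id → a′ ∘ y ≈ x ∘ b′
  inverse-square {a = a} {x} {y} {b} {a′} {b′} sq a′a bb′ = begin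
    a′ ∘ y                ≈⟨ refl⟩∘⟨ ≈-sym (≈-trans (refl⟩∘⟨ bb′) identityʳ) ⟩
    a′ ∘ (y ∘ (b ∘ b′))   ≈⟨ refl⟩∘⟨ ≈-sym assoc ⟩
    a′ ∘ ((y ∘ b) ∘ b′)   ≈⟨ refl⟩∘⟨ ≈-sym sq ⟩∘⟨refl ⟩
    a′ ∘ ((a ∘ x) ∘ b′)   ≈⟨ refl⟩∘⟨ assoc ⟩
    a′ ∘ (a ∘ (x ∘ b′))   ≈⟨ ≈-sym assoc ⟩
    (a′ ∘ a) ∘ (x ∘ b′)   ≈⟨ a′a ⟩∘⟨refl ⟩
    id ∘ (x ∘ b′)         ≈⟨ identityˡ ⟩
    x ∘ b′                ∎
    where open HomReasoning

  idₑ-swapˡ : (p : X ≡ Y) → idₑ p ∘ x ≈ y → x ≈ idₑ (sym p) ∘ y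
  idₑ-swapˡ refl q = ≈-trans (≈-sym identityˡ) (≈-trans q (≈-sym identityˡ))

  idₑ-swapʳ : (p : X ≡ Y) → x ∘ idₑ p ≈ y → x ≈ y ∘ idₑ (sym p)
  idₑ-swapʳ refl q = ≈-trans (≈-sym identityʳ) (≈-trans q (≈-sym identityʳ))

  idₑ-epi : (p : X ≡ Y) → x ∘ idₑ p ≈ y ∘ idₑ p → x ≈ y
  idₑ-epi refl q = ≈-trans (≈-sym identityʳ) (≈-trans q identityʳ)

  idₑ-cancelʳ : (p : X ≡ Y) → (x ∘ idₑ p) ∘ idₑ (sym p) ≈ x
  idₑ-cancelʳ refl = ≈-trans identityʳ identityʳ

  idₑ-sym-cancelʳ : (p : X ≡ Y) → (x ∘ idₑ (sym p)) ∘ idₑ p ≈ x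
  idₑ-sym-cancelʳ refl = ≈-trans identityʳ identityʳ

  id-IsIso : IsIso (id {X})
  id-IsIso = id , identityˡ , identityˡ

  idₑ-IsIso : (p : X ≡ Y) → IsIso (idₑ p)
  idₑ-IsIso refl = id-IsIso

  IsIso-resp-≈ : f ≈ g → IsIso f → IsIso g
  IsIso-resp-≈ f≈g (f⁻¹ , inv₁ , inv₂) =
    f⁻¹ , ≈-trans (refl⟩∘⟨ ≈-sym f≈g) inv₁ , ≈-trans (≈-sym f≈g ⟩∘⟨refl) inv₂

  cancelInner : h ∘ k ≈ id → (f ∘ h) ∘ (k ∘ g) ≈ f ∘ g
  cancelInner {h = h} {k = k} {f = f} {g = g} hk = begin
    (f ∘ h) ∘ (k ∘ g) ≈⟨ assoc ⟩
    f ∘ (h ∘ (k ∘ g)) ≈⟨ refl⟩∘⟨ ≈-sym assoc ⟩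
    f ∘ ((h ∘ k) ∘ g) ≈⟨ refl⟩∘⟨ hk ⟩∘⟨refl ⟩
    f ∘ (id ∘ g)      ≈⟨ refl⟩∘⟨ identityˡ ⟩
    f ∘ g             ∎
    where open HomReasoning

  IsIso-∘ : {f : Y ⇒ Z} {g : X ⇒ Y} → IsIso f → IsIso g → IsIso (f ∘ g)
  IsIso-∘ (f⁻¹ , f⁻¹f , ff⁻¹) (g⁻¹ , g⁻¹g , gg⁻¹) =
    g⁻¹ ∘ f⁻¹ ,
    ≈-trans (cancelInner f⁻¹f) g⁻¹g ,
    ≈-trans (cancelInner gg⁻¹) ff⁻¹

  iso-two-out-of-three : {f : Y ⇒ Z} {g : X ⇒ Y} {h : X ⇒ Z} →
                         f ∘ g ≈ h → IsIso g → IsIso h → IsIso f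
  iso-two-out-of-three {f = f} {g} {h} fg≈h (g⁻¹ , g⁻¹g , gg⁻¹) h-iso =
    IsIso-resp-≈ f≈hg⁻¹ (IsIso-∘ h-iso (g , gg⁻¹ , g⁻¹g))
    where
    open HomReasoning
    f≈hg⁻¹ : h ∘ g⁻¹ ≈ f
    f≈hg⁻¹ = begin
      h ∘ g⁻¹         ≈⟨ ≈-sym fg≈h ⟩∘⟨refl ⟩
      (f ∘ g) ∘ g⁻¹   ≈⟨ assoc ⟩
      f ∘ (g ∘ g⁻¹)   ≈⟨ refl⟩∘⟨ gg⁻¹ ⟩
      f ∘ id          ≈⟨ identityʳ ⟩
      f               ∎

  IsIso⇒Mono : IsIso f → Mono f
  IsIso⇒Mono {f = f} (f⁻¹ , f⁻¹f , _) x y fx≈fy = begin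
    x                    ≈⟨ ≈-sym identityˡ ⟩
    id ∘ x               ≈⟨ ≈-sym (cancelInner f⁻¹f) ⟩
    (id ∘ f⁻¹) ∘ (f ∘ x) ≈⟨ refl⟩∘⟨ fx≈fy ⟩
    (id ∘ f⁻¹) ∘ (f ∘ y) ≈⟨ cancelInner f⁻¹f ⟩
    id ∘ y               ≈⟨ identityˡ ⟩
    y                    ∎
    where open HomReasoning

  Mono-∘ : {f : Y ⇒ Z} {g : X ⇒ Y} → Mono f → Mono g → Mono (f ∘ g)
  Mono-∘ f-mono g-mono x y fgx≈fgy =
    g-mono x y (f-mono _ _ (≈-trans (≈-sym assoc) (≈-trans fgx≈fgy assoc)))

  Mono-resp-≈ : f ≈ g → Mono f → Mono g
  Mono-resp-≈ f≈g f-mono x y gx≈gy =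
    f-mono x y (≈-trans (f≈g ⟩∘⟨refl) (≈-trans gx≈gy (≈-sym f≈g ⟩∘⟨refl)))

module FibrationProperties {oe ℓe ee ob ℓb eb} {E : Category oe ℓe ee} {B : Category ob ℓb eb}
                           (U : Functor E B) where
  private
    module E = Properties E
    module B = Properties B
    module U = Functor U

    variable
      P Q R : E.Obj
      X Y Z : B.Obj
      φ φ′ ψ : P E.⇒ Q
      f f′ g′ : X B.⇒ Y

  -- φ lies over f up to the identifications i and j of base objects; this is the square
  -- required of a morphism of a change of base.
  record Over (φ : P E.⇒ Q) (f : X B.⇒ Y) (i : X ≡ U.F₀ P) (j : Y ≡ U.F₀ Q) : Set eb where
    constructor mkOver
    field square : U.F₁ φ B.∘ B.idₑ i B.≈ B.idₑ j B.∘ f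

  over-resp-≈ : ∀ {i j} → f B.≈ f′ → Over φ f i j → Over φ f′ i j
  over-resp-≈ f≈f′ (mkOver sq) = mkOver (B.≈-trans sq (B.refl⟩∘⟨ f≈f′))

  over-∘ : ∀ {i j k} → Over ψ g′ j k → Over φ f i j → Over (ψ E.∘ φ) (g′ B.∘ f) i k
  over-∘ (mkOver sq₂) (mkOver sq₁) =
    mkOver (B.≈-trans (U.homomorphism B.⟩∘⟨refl) (B.glue sq₂ sq₁))

  over-unique : ∀ {i j} → Over φ f i j → Over φ′ f i j → U.F₁ φ B.≈ U.F₁ φ′
  over-unique {i = i} (mkOver sq) (mkOver sq′) = B.idₑ-epi i (B.≈-trans sq (B.≈-sym sq′))

  over-inverse : ∀ {i j} {φ⁻¹ : Q E.⇒ P} {f⁻¹ : Y B.⇒ X} → Over φ f i j →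
                 φ⁻¹ E.∘ φ E.≈ E.id → f B.∘ f⁻¹ B.≈ B.id → Over φ⁻¹ f⁻¹ j i
  over-inverse (mkOver sq) φ⁻¹φ ff⁻¹ = mkOver (B.inverse-square sq
    (B.≈-trans (B.≈-sym U.homomorphism) (B.≈-trans (U.F-resp-≈ φ⁻¹φ) U.identity)) ff⁻¹)

  over-Mono : ∀ {i j} → Over φ f i j → B.Mono f → B.Mono (U.F₁ φ)
  over-Mono {i = i} {j} (mkOver sq) f-mono = B.Mono-resp-≈ (B.≈-sym (B.idₑ-swapʳ i sq))
    (B.Mono-∘ (B.Mono-∘ (B.IsIso⇒Mono (B.idₑ-IsIso j)) f-mono)
              (B.IsIso⇒Mono (B.idₑ-IsIso (sym i))))

  opcartLift-over : ∀ {i : X ≡ U.F₀ P} (l : OpcartLift U (f B.∘ B.idₑ (sym i))) →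
                    Over (OpcartLift.arr l) f i (sym (OpcartLift.eq l))
  opcartLift-over {f = f} {i = i} l = mkOver (begin
    U.F₁ (arr l) B.∘ B.idₑ i
      ≈⟨ B.idₑ-swapˡ (eq l) (over l) B.⟩∘⟨refl ⟩
    (B.idₑ (sym (eq l)) B.∘ (f B.∘ B.idₑ (sym i))) B.∘ B.idₑ i
      ≈⟨ B.assoc ⟩
    B.idₑ (sym (eq l)) B.∘ ((f B.∘ B.idₑ (sym i)) B.∘ B.idₑ i)
      ≈⟨ B.refl⟩∘⟨ B.idₑ-sym-cancelʳ i ⟩
    B.idₑ (sym (eq l)) B.∘ f ∎)
    where open B.HomReasoning
          open OpcartLift

  cartLift-over : ∀ {j : Y ≡ U.F₀ Q} (l : CartLift U (B.idₑ j B.∘ f)) →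
                  Over (CartLift.arr l) f (sym (CartLift.eq l)) j
  cartLift-over l =
    mkOver (B.≈-trans (CartLift.over l B.⟩∘⟨refl) (B.idₑ-cancelʳ (CartLift.eq l)))

  opcart-unique : IsOpcartesian U ψ → {k k′ : Q E.⇒ R} →
                  U.F₁ k B.≈ U.F₁ k′ → k E.∘ ψ E.≈ k′ E.∘ ψ → k E.≈ k′
  opcart-unique {ψ = ψ} ψ-opcart {k} {k′} Uk≈Uk′ kψ≈k′ψ =
    let (_ , _ , _ , unique) = ψ-opcart (k E.∘ ψ) (U.F₁ k) U.homomorphism
    in E.≈-trans (unique k B.≈-refl E.≈-refl)
                 (E.≈-sym (unique k′ (B.≈-sym Uk≈Uk′) (E.≈-sym kψ≈k′ψ)))

  cart-unique : IsCartesian U φ → {k k′ : R E.⇒ P} →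
                U.F₁ k B.≈ U.F₁ k′ → φ E.∘ k E.≈ φ E.∘ k′ → k E.≈ k′
  cart-unique {φ = φ} φ-cart {k} {k′} Uk≈Uk′ φk≈φk′ =
    let (_ , _ , _ , unique) = φ-cart (φ E.∘ k) (U.F₁ k) U.homomorphism
    in E.≈-trans (unique k B.≈-refl E.≈-refl)
                 (E.≈-sym (unique k′ (B.≈-sym Uk≈Uk′) (E.≈-sym φk≈φk′)))

  opcart-factor : ∀ {i j k} {g : P E.⇒ R} {w : Y B.⇒ Z} → IsOpcartesian U ψ →
                  Over ψ f i j → Over g (w B.∘ f) i k →
                  Σ[ v ∈ Q E.⇒ R ] (Over v w j k × v E.∘ ψ E.≈ g)
  opcart-factor {i = i} {j} {k} {g} {w} ψ-opcart (mkOver ψ-sq) (mkOver g-sq) =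
    let (v , Uv≈h , vψ≈g , _) =
          ψ-opcart g h (B.idₑ-epi i (B.≈-trans g-sq (B.≈-sym (B.glue h-sq ψ-sq))))
    in v , mkOver (B.≈-trans (Uv≈h B.⟩∘⟨refl) h-sq) , vψ≈g
    where
    h = (B.idₑ k B.∘ w) B.∘ B.idₑ (sym j)
    h-sq : h B.∘ B.idₑ j B.≈ B.idₑ k B.∘ w
    h-sq = B.idₑ-sym-cancelʳ j

  cart-factor : ∀ {i j k} {g : R E.⇒ Q} {w : X B.⇒ Y} → IsCartesian U φ →
                Over φ f j k → Over g (f B.∘ w) i k →
                Σ[ v ∈ R E.⇒ P ] (Over v w i j × φ E.∘ v E.≈ g)
  cart-factor {i = i} {j} {k} {g} {w} φ-cart (mkOver φ-sq) (mkOver g-sq) =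
    let (v , Uv≈h , φv≈g , _) =
          φ-cart g h (B.idₑ-epi i (B.≈-trans g-sq (B.≈-sym (B.glue φ-sq h-sq))))
    in v , mkOver (B.≈-trans (Uv≈h B.⟩∘⟨refl) h-sq) , φv≈g
    where
    h = (B.idₑ j B.∘ w) B.∘ B.idₑ (sym i)
    h-sq : h B.∘ B.idₑ i B.≈ B.idₑ j B.∘ w
    h-sq = B.idₑ-sym-cancelʳ i

  cart-Mono : IsCartesian U φ → B.Mono (U.F₁ φ) → E.Mono φ
  cart-Mono φ-cart Uφ-mono x y φx≈φy = cart-unique φ-cart
    (Uφ-mono _ _ (B.≈-trans (B.≈-sym U.homomorphism)
                            (B.≈-trans (U.F-resp-≈ φx≈φy) U.homomorphism)))
    φx≈φy

  cart-IsIso : IsCartesian U φ → B.IsIso (U.F₁ φ) → E.IsIso φ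
  cart-IsIso {φ = φ} φ-cart (Uφ⁻¹ , Uφ⁻¹Uφ , UφUφ⁻¹) =
    let (φ⁻¹ , Uφ⁻¹≈ , φφ⁻¹ , _) = φ-cart E.id Uφ⁻¹ (B.≈-trans U.identity (B.≈-sym UφUφ⁻¹))
    in φ⁻¹ ,
       cart-unique φ-cart
         (B.≈-trans U.homomorphism
           (B.≈-trans (Uφ⁻¹≈ B.⟩∘⟨refl) (B.≈-trans Uφ⁻¹Uφ (B.≈-sym U.identity))))
         (E.≈-trans (E.≈-sym E.assoc) (E.≈-trans (φφ⁻¹ E.⟩∘⟨refl) E.id-comm-sym)) ,
       φφ⁻¹

  opcart-IsIso : IsOpcartesian U ψ → B.IsIso (U.F₁ ψ) → E.IsIso ψ
  opcart-IsIso {ψ = ψ} ψ-opcart (Uψ⁻¹ , Uψ⁻¹Uψ , UψUψ⁻¹) =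
    let (ψ⁻¹ , Uψ⁻¹≈ , ψ⁻¹ψ , _) = ψ-opcart E.id Uψ⁻¹ (B.≈-trans U.identity (B.≈-sym Uψ⁻¹Uψ))
    in ψ⁻¹ ,
       ψ⁻¹ψ ,
       opcart-unique ψ-opcart
         (B.≈-trans U.homomorphism
           (B.≈-trans (B.refl⟩∘⟨ Uψ⁻¹≈) (B.≈-trans UψUψ⁻¹ (B.≈-sym U.identity))))
         (E.≈-trans E.assoc (E.≈-trans (E.refl⟩∘⟨ ψ⁻¹ψ) E.id-comm))

  cartLift-IsIso : (l : CartLift U f) → B.IsIso f → E.IsIso (CartLift.arr l)
  cartLift-IsIso l f-iso = cart-IsIso (CartLift.cart l)
    (B.IsIso-resp-≈ (B.≈-sym (CartLift.over l)) (B.IsIso-∘ f-iso (B.idₑ-IsIso (CartLift.eq l))))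

  opcartLift-IsIso : (l : OpcartLift U f) → B.IsIso f → E.IsIso (OpcartLift.arr l)
  opcartLift-IsIso l f-iso = opcart-IsIso (OpcartLift.opcart l)
    (B.IsIso-resp-≈ (B.≈-sym (B.idₑ-swapˡ (OpcartLift.eq l) (OpcartLift.over l)))
                    (B.IsIso-∘ (B.idₑ-IsIso (sym (OpcartLift.eq l))) f-iso))

  Mono⇒kernelPair : B.Mono f → IsPullback U f f B.id B.id
  Mono⇒kernelPair f-mono = record
    { commute   = B.≈-refl
    ; universal = λ a b fa≈fb →
        a , B.identityˡ , B.≈-trans B.identityˡ (f-mono a b fa≈fb) ,
        λ u ida≈a _ → B.≈-trans (B.≈-sym B.identityˡ) ida≈a
    }

module _ {oa ℓa ea oe ℓe ee ob ℓb eb}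
         {A : Category oa ℓa ea} {E : Category oe ℓe ee} {B : Category ob ℓb eb}
         {U : Functor E B} {H : Functor A B} where
  private
    module A = Properties A
    module E = Properties E
    module B = Properties B
    module H = Functor H
  open FibrationProperties U

  CHom-over : ∀ {o o′} (m : CHom U H o o′) →
              Over (CHom.g m) (H.F₁ (CHom.h m)) (CObj.e o) (CObj.e o′)
  CHom-over m = mkOver (CHom.comm m)

  CHom-IsIso : ∀ {o o′} (m : CHom U H o o′) → A.IsIso (CHom.h m) → E.IsIso (CHom.g m) →
               Category.IsIso (ChangeOfBase U H) m
  CHom-IsIso m@(chom h g _) (h⁻¹ , h⁻¹h , hh⁻¹) (g⁻¹ , g⁻¹g , gg⁻¹) =
    chom h⁻¹ g⁻¹ (Over.square (over-inverse (CHom-over m) g⁻¹g Hh∘Hh⁻¹≈id)) ,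
    (h⁻¹h , g⁻¹g) ,
    (hh⁻¹ , gg⁻¹)
    where
    Hh∘Hh⁻¹≈id : H.F₁ h B.∘ H.F₁ h⁻¹ B.≈ B.id
    Hh∘Hh⁻¹≈id = B.≈-trans (B.≈-sym H.homomorphism) (B.≈-trans (H.F-resp-≈ hh⁻¹) H.identity)

module _ {o ℓ e o′ ℓ′ e′} {C : Category o ℓ e} {D : Category o′ ℓ′ e′}
         {L : Functor C D} {R : Functor D C} (adj : Adjunction L R) where
  private
    module C = Properties C
    module D = Properties D
    module L = Functor L
    module R = Functor R
  open Adjunction adj

  unitIso⇒fullyFaithful : (∀ X → C.IsIso (unit X)) → FullyFaithful L
  unitIso⇒fullyFaithful unit-iso = record { full = full ; faithful = faithful }
    where
    faithful : ∀ {X Y} (f g : X C.⇒ Y) → L.F₁ f D.≈ L.F₁ g → f C.≈ g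
    faithful {Y = Y} f g Lf≈Lg = C.IsIso⇒Mono (unit-iso Y) f g (begin
      unit Y C.∘ f                 ≈⟨ C.≈-sym (unit-natural f) ⟩
      R.F₁ (L.F₁ f) C.∘ unit _     ≈⟨ R.F-resp-≈ Lf≈Lg C.⟩∘⟨refl ⟩
      R.F₁ (L.F₁ g) C.∘ unit _     ≈⟨ unit-natural g ⟩
      unit Y C.∘ g                 ∎)
      where open C.HomReasoning

    full : ∀ {X Y} (k : L.F₀ X D.⇒ L.F₀ Y) → Σ[ f ∈ X C.⇒ Y ] L.F₁ f D.≈ k
    full {X} {Y} k = f , (begin
      L.F₁ f                                        ≈⟨ D.≈-sym D.identityˡ ⟩
      D.id D.∘ L.F₁ f                               ≈⟨ D.≈-sym (zig Y) D.⟩∘⟨refl ⟩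
      (counit _ D.∘ L.F₁ (unit Y)) D.∘ L.F₁ f        ≈⟨ D.assoc ⟩
      counit _ D.∘ (L.F₁ (unit Y) D.∘ L.F₁ f)        ≈⟨ D.refl⟩∘⟨ D.≈-sym L.homomorphism ⟩
      counit _ D.∘ L.F₁ (unit Y C.∘ f)               ≈⟨ D.refl⟩∘⟨ L.F-resp-≈ ηf≈Rkη ⟩
      counit _ D.∘ L.F₁ (R.F₁ k C.∘ unit X)          ≈⟨ D.refl⟩∘⟨ L.homomorphism ⟩
      counit _ D.∘ (L.F₁ (R.F₁ k) D.∘ L.F₁ (unit X)) ≈⟨ D.≈-sym D.assoc ⟩
      (counit _ D.∘ L.F₁ (R.F₁ k)) D.∘ L.F₁ (unit X) ≈⟨ D.≈-sym (counit-natural k) D.⟩∘⟨refl ⟩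
      (k D.∘ counit _) D.∘ L.F₁ (unit X)             ≈⟨ D.assoc ⟩
      k D.∘ (counit _ D.∘ L.F₁ (unit X))             ≈⟨ D.refl⟩∘⟨ zig X ⟩
      k D.∘ D.id                                    ≈⟨ D.identityʳ ⟩
      k                                             ∎)
      where
      open D.HomReasoning
      η⁻¹ = proj₁ (unit-iso Y)
      f = η⁻¹ C.∘ (R.F₁ k C.∘ unit X)
      ηf≈Rkη : unit Y C.∘ f C.≈ R.F₁ k C.∘ unit X
      ηf≈Rkη = C.≈-trans (C.≈-sym C.assoc)
                 (C.≈-trans (proj₂ (proj₂ (unit-iso Y)) C.⟩∘⟨refl) C.identityˡ)

module ΣαConstruction {oa ℓa ea oe ℓe ee ob ℓb eb}
  {A : Category oa ℓa ea} {E : Category oe ℓe ee} {B : Category ob ℓb eb}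
  (U : Functor E B) (bif : Bifibration U) {F G : Functor A B} (α : NatTrans F G) where
  private
    module A = Properties A
    module E = Properties E
    module B = Properties B
    module F = Functor F
    module G = Functor G
    module α = NatTrans α
    module bif = Bifibration bif
    F*E = ChangeOfBase U F
    G*E = ChangeOfBase U G
    module F*E = Category F*E
    module G*E = Category G*E
  open FibrationProperties U
  open CObj
  open CHom

  Σα₀ : CObj U F → CObj U G
  Σα₀ = ΣαObj U bif α

  α*₀ : CObj U G → CObj U F
  α*₀ = α*Obj U bif α

  ψ : (o : CObj U F) → P o E.⇒ P (Σα₀ o)
  ψ o = OpcartLift.arr (bif.opcartLift (α.η (X o) B.∘ B.idₑ (sym (e o))))

  ψ-over : (o : CObj U F) → Over (ψ o) (α.η (X o)) (e o) (e (Σα₀ o))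
  ψ-over o = opcartLift-over (bif.opcartLift _)

  ψ-opcart : (o : CObj U F) → IsOpcartesian U (ψ o)
  ψ-opcart o = OpcartLift.opcart (bif.opcartLift _)

  φ : (o : CObj U G) → P (α*₀ o) E.⇒ P o
  φ o = CartLift.arr (bif.cartLift (B.idₑ (e o) B.∘ α.η (X o)))

  φ-over : (o : CObj U G) → Over (φ o) (α.η (X o)) (e (α*₀ o)) (e o)
  φ-over o = cartLift-over (bif.cartLift _)

  φ-cart : (o : CObj U G) → IsCartesian U (φ o)
  φ-cart o = CartLift.cart (bif.cartLift _)

  Σα-hom-unique : ∀ o {o′} (m m′ : CHom U G (Σα₀ o) o′) →
                  h m A.≈ h m′ → g m E.∘ ψ o E.≈ g m′ E.∘ ψ o → m G*E.≈ m′
  Σα-hom-unique o m m′ h≈h′ gψ≈g′ψ = h≈h′ ,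
    opcart-unique (ψ-opcart o)
      (over-unique (CHom-over m) (over-resp-≈ (G.F-resp-≈ (A.≈-sym h≈h′)) (CHom-over m′)))
      gψ≈g′ψ

  α*-hom-unique : ∀ {o} o′ (m m′ : CHom U F o (α*₀ o′)) →
                  h m A.≈ h m′ → φ o′ E.∘ g m E.≈ φ o′ E.∘ g m′ → m F*E.≈ m′
  α*-hom-unique o′ m m′ h≈h′ φg≈φg′ = h≈h′ ,
    cart-unique (φ-cart o′)
      (over-unique (CHom-over m) (over-resp-≈ (F.F-resp-≈ (A.≈-sym h≈h′)) (CHom-over m′)))
      φg≈φg′

  Σα-lift : ∀ {o o′} (m : CHom U F o o′) →
            Σ[ k ∈ P (Σα₀ o) E.⇒ P (Σα₀ o′) ]
              (Over k (G.F₁ (h m)) (e (Σα₀ o)) (e (Σα₀ o′)) × k E.∘ ψ o E.≈ ψ o′ E.∘ g m)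
  Σα-lift {o} {o′} m = opcart-factor (ψ-opcart o) (ψ-over o)
    (over-resp-≈ (α.commute (h m)) (over-∘ (ψ-over o′) (CHom-over m)))

  Σα₁ : ∀ {o o′} → CHom U F o o′ → CHom U G (Σα₀ o) (Σα₀ o′)
  Σα₁ m = chom (h m) (proj₁ (Σα-lift m)) (Over.square (proj₁ (proj₂ (Σα-lift m))))

  Σα₁-ψ : ∀ {o o′} (m : CHom U F o o′) → g (Σα₁ m) E.∘ ψ o E.≈ ψ o′ E.∘ g m
  Σα₁-ψ m = proj₂ (proj₂ (Σα-lift m))

  Σα : Functor F*E G*E
  Σα = record
    { F₀           = Σα₀
    ; F₁           = Σα₁
    ; identity     = λ {o} → Σα-hom-unique o (Σα₁ (F*E.id {o})) G*E.id A.≈-refl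
        (E.≈-trans (Σα₁-ψ (F*E.id {o})) E.id-comm)
    ; homomorphism = λ {o} {f = m₁} {m₂} →
        Σα-hom-unique o (Σα₁ (m₂ F*E.∘ m₁)) (Σα₁ m₂ G*E.∘ Σα₁ m₁) A.≈-refl
        (E.≈-trans (Σα₁-ψ (m₂ F*E.∘ m₁)) (E.≈-sym (E.glue (Σα₁-ψ m₂) (Σα₁-ψ m₁))))
    ; F-resp-≈     = λ {o} {f = m} {m′} (h≈h′ , g≈g′) →
        Σα-hom-unique o (Σα₁ m) (Σα₁ m′) h≈h′
        (E.≈-trans (Σα₁-ψ m) (E.≈-trans (E.refl⟩∘⟨ g≈g′) (E.≈-sym (Σα₁-ψ m′))))
    }

  α*-lift : ∀ {o o′} (m : CHom U G o o′) →
            Σ[ k ∈ P (α*₀ o) E.⇒ P (α*₀ o′) ]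
              (Over k (F.F₁ (h m)) (e (α*₀ o)) (e (α*₀ o′)) × φ o′ E.∘ k E.≈ g m E.∘ φ o)
  α*-lift {o} {o′} m = cart-factor (φ-cart o′) (φ-over o′)
    (over-resp-≈ (B.≈-sym (α.commute (h m))) (over-∘ (CHom-over m) (φ-over o)))

  α*₁ : ∀ {o o′} → CHom U G o o′ → CHom U F (α*₀ o) (α*₀ o′)
  α*₁ m = chom (h m) (proj₁ (α*-lift m)) (Over.square (proj₁ (proj₂ (α*-lift m))))

  α*₁-φ : ∀ {o o′} (m : CHom U G o o′) → φ o′ E.∘ g (α*₁ m) E.≈ g m E.∘ φ o
  α*₁-φ m = proj₂ (proj₂ (α*-lift m))

  α* : Functor G*E F*E
  α* = record
    { F₀           = α*₀
    ; F₁           = α*₁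
    ; identity     = λ {o} → α*-hom-unique o (α*₁ (G*E.id {o})) F*E.id A.≈-refl
        (E.≈-trans (α*₁-φ (G*E.id {o})) E.id-comm-sym)
    ; homomorphism = λ {Z = o} {f = m₁} {m₂} →
        α*-hom-unique o (α*₁ (m₂ G*E.∘ m₁)) (α*₁ m₂ F*E.∘ α*₁ m₁) A.≈-refl
        (E.≈-trans (α*₁-φ (m₂ G*E.∘ m₁)) (E.glue (E.≈-sym (α*₁-φ m₂)) (E.≈-sym (α*₁-φ m₁))))
    ; F-resp-≈     = λ {B = o} {f = m} {m′} (h≈h′ , g≈g′) →
        α*-hom-unique o (α*₁ m) (α*₁ m′) h≈h′
        (E.≈-trans (α*₁-φ m) (E.≈-trans (g≈g′ E.⟩∘⟨refl) (E.≈-sym (α*₁-φ m′))))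
    }

  unit-lift : (o : CObj U F) →
              Σ[ u ∈ P o E.⇒ P (α*₀ (Σα₀ o)) ]
                (Over u (F.F₁ A.id) (e o) (e (α*₀ (Σα₀ o))) × φ (Σα₀ o) E.∘ u E.≈ ψ o)
  unit-lift o = cart-factor (φ-cart (Σα₀ o)) (φ-over (Σα₀ o))
    (over-resp-≈ (B.≈-sym (B.≈-trans (B.refl⟩∘⟨ F.identity) B.identityʳ)) (ψ-over o))

  unit : (o : CObj U F) → CHom U F o (α*₀ (Σα₀ o))
  unit o = chom A.id (proj₁ (unit-lift o)) (Over.square (proj₁ (proj₂ (unit-lift o))))

  unit-φ : (o : CObj U F) → φ (Σα₀ o) E.∘ g (unit o) E.≈ ψ o
  unit-φ o = proj₂ (proj₂ (unit-lift o))

  counit-lift : (o : CObj U G) →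
                Σ[ c ∈ P (Σα₀ (α*₀ o)) E.⇒ P o ]
                  (Over c (G.F₁ A.id) (e (Σα₀ (α*₀ o))) (e o) × c E.∘ ψ (α*₀ o) E.≈ φ o)
  counit-lift o = opcart-factor (ψ-opcart (α*₀ o)) (ψ-over (α*₀ o))
    (over-resp-≈ (B.≈-sym (B.≈-trans (G.identity B.⟩∘⟨refl) B.identityˡ)) (φ-over o))

  counit : (o : CObj U G) → CHom U G (Σα₀ (α*₀ o)) o
  counit o = chom A.id (proj₁ (counit-lift o)) (Over.square (proj₁ (proj₂ (counit-lift o))))

  counit-ψ : (o : CObj U G) → g (counit o) E.∘ ψ (α*₀ o) E.≈ φ o
  counit-ψ o = proj₂ (proj₂ (counit-lift o))

  adjunction : Adjunction Σα α*
  adjunction = record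
    { unit           = unit
    ; counit         = counit
    ; unit-natural   = λ {o} {o′} m →
        α*-hom-unique (Σα₀ o′) (α*₁ (Σα₁ m) F*E.∘ unit o) (unit o′ F*E.∘ m) A.id-comm
          (unit-natural-φ m)
    ; counit-natural = λ {o} {o′} m →
        Σα-hom-unique (α*₀ o) (m G*E.∘ counit o) (counit o′ G*E.∘ Σα₁ (α*₁ m)) A.id-comm
          (counit-natural-ψ m)
    ; zig            = λ o →
        Σα-hom-unique o (counit (Σα₀ o) G*E.∘ Σα₁ (unit o)) G*E.id A.identityˡ (zig-ψ o)
    ; zag            = λ o →
        α*-hom-unique o (α*₁ (counit o) F*E.∘ unit (α*₀ o)) F*E.id A.identityˡ (zag-φ o)
    }
    where
    open E.HomReasoning

    unit-natural-φ : ∀ {o o′} (m : CHom U F o o′) →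
                     φ (Σα₀ o′) E.∘ (g (α*₁ (Σα₁ m)) E.∘ g (unit o))
                       E.≈ φ (Σα₀ o′) E.∘ (g (unit o′) E.∘ g m)
    unit-natural-φ {o} {o′} m = begin
      φ (Σα₀ o′) E.∘ (g (α*₁ (Σα₁ m)) E.∘ g (unit o))   ≈⟨ E.≈-sym E.assoc ⟩
      (φ (Σα₀ o′) E.∘ g (α*₁ (Σα₁ m))) E.∘ g (unit o)   ≈⟨ α*₁-φ (Σα₁ m) E.⟩∘⟨refl ⟩
      (g (Σα₁ m) E.∘ φ (Σα₀ o)) E.∘ g (unit o)          ≈⟨ E.assoc ⟩
      g (Σα₁ m) E.∘ (φ (Σα₀ o) E.∘ g (unit o))          ≈⟨ E.refl⟩∘⟨ unit-φ o ⟩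
      g (Σα₁ m) E.∘ ψ o                                 ≈⟨ Σα₁-ψ m ⟩
      ψ o′ E.∘ g m                                      ≈⟨ E.≈-sym (unit-φ o′) E.⟩∘⟨refl ⟩
      (φ (Σα₀ o′) E.∘ g (unit o′)) E.∘ g m              ≈⟨ E.assoc ⟩
      φ (Σα₀ o′) E.∘ (g (unit o′) E.∘ g m)              ∎

    counit-natural-ψ : ∀ {o o′} (m : CHom U G o o′) →
                       (g m E.∘ g (counit o)) E.∘ ψ (α*₀ o)
                         E.≈ (g (counit o′) E.∘ g (Σα₁ (α*₁ m))) E.∘ ψ (α*₀ o)
    counit-natural-ψ {o} {o′} m = begin
      (g m E.∘ g (counit o)) E.∘ ψ (α*₀ o)                ≈⟨ E.assoc ⟩
      g m E.∘ (g (counit o) E.∘ ψ (α*₀ o))                ≈⟨ E.refl⟩∘⟨ counit-ψ o ⟩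
      g m E.∘ φ o                                         ≈⟨ E.≈-sym (α*₁-φ m) ⟩
      φ o′ E.∘ g (α*₁ m)                                  ≈⟨ E.≈-sym (counit-ψ o′) E.⟩∘⟨refl ⟩
      (g (counit o′) E.∘ ψ (α*₀ o′)) E.∘ g (α*₁ m)        ≈⟨ E.assoc ⟩
      g (counit o′) E.∘ (ψ (α*₀ o′) E.∘ g (α*₁ m))        ≈⟨ E.refl⟩∘⟨ E.≈-sym (Σα₁-ψ (α*₁ m)) ⟩
      g (counit o′) E.∘ (g (Σα₁ (α*₁ m)) E.∘ ψ (α*₀ o))   ≈⟨ E.≈-sym E.assoc ⟩
      (g (counit o′) E.∘ g (Σα₁ (α*₁ m))) E.∘ ψ (α*₀ o)   ∎

    zig-ψ : ∀ o → (g (counit (Σα₀ o)) E.∘ g (Σα₁ (unit o))) E.∘ ψ o E.≈ E.id E.∘ ψ o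
    zig-ψ o = begin
      (g (counit (Σα₀ o)) E.∘ g (Σα₁ (unit o))) E.∘ ψ o           ≈⟨ E.assoc ⟩
      g (counit (Σα₀ o)) E.∘ (g (Σα₁ (unit o)) E.∘ ψ o)           ≈⟨ E.refl⟩∘⟨ Σα₁-ψ (unit o) ⟩
      g (counit (Σα₀ o)) E.∘ (ψ (α*₀ (Σα₀ o)) E.∘ g (unit o))     ≈⟨ E.≈-sym E.assoc ⟩
      (g (counit (Σα₀ o)) E.∘ ψ (α*₀ (Σα₀ o))) E.∘ g (unit o)     ≈⟨ counit-ψ (Σα₀ o) E.⟩∘⟨refl ⟩
      φ (Σα₀ o) E.∘ g (unit o)                                    ≈⟨ unit-φ o ⟩
      ψ o                                                         ≈⟨ E.≈-sym E.identityˡ ⟩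
      E.id E.∘ ψ o                                                ∎

    zag-φ : ∀ o → φ o E.∘ (g (α*₁ (counit o)) E.∘ g (unit (α*₀ o))) E.≈ φ o E.∘ E.id
    zag-φ o = begin
      φ o E.∘ (g (α*₁ (counit o)) E.∘ g (unit (α*₀ o)))           ≈⟨ E.≈-sym E.assoc ⟩
      (φ o E.∘ g (α*₁ (counit o))) E.∘ g (unit (α*₀ o))           ≈⟨ α*₁-φ (counit o) E.⟩∘⟨refl ⟩
      (g (counit o) E.∘ φ (Σα₀ (α*₀ o))) E.∘ g (unit (α*₀ o))     ≈⟨ E.assoc ⟩
      g (counit o) E.∘ (φ (Σα₀ (α*₀ o)) E.∘ g (unit (α*₀ o)))     ≈⟨ E.refl⟩∘⟨ unit-φ (α*₀ o) ⟩
      g (counit o) E.∘ ψ (α*₀ o)                                  ≈⟨ counit-ψ o ⟩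
      φ o                                                         ≈⟨ E.≈-sym E.identityʳ ⟩
      φ o E.∘ E.id                                                ∎

  Σα⊣α* : ΣαAdjunction U bif α
  Σα⊣α* = record
    { Σα         = Σα
    ; α*         = α*
    ; Σα-obj     = λ _ → refl
    ; α*-obj     = λ _ → refl
    ; Σα-proj    = λ _ → A.id-comm-sym
    ; α*-proj    = λ _ → A.id-comm-sym
    ; adjunction = adjunction
    }

  unit-IsIso : BeckChevalley U bif → (∀ X → B.Mono (α.η X)) → ∀ o → F*E.IsIso (unit o)
  unit-IsIso bc α-mono o = CHom-IsIso (unit o) A.id-IsIso
    (E.iso-two-out-of-three u∘ct≈k∘os ct-iso (E.IsIso-∘ k-iso os-iso))
    where
    -- the liftings of t = s = id that BeckChevalley builds for the kernel pair of α_X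
    ct = bif.cartLift (B.idₑ (sym (sym (e o))) B.∘ B.id)
    os = bif.opcartLift (B.id B.∘ B.idₑ (CartLift.eq ct))

    ct-iso : E.IsIso (CartLift.arr ct)
    ct-iso = cartLift-IsIso ct (B.IsIso-∘ (B.idₑ-IsIso (sym (sym (e o)))) B.id-IsIso)

    os-iso : E.IsIso (OpcartLift.arr os)
    os-iso = opcartLift-IsIso os (B.IsIso-∘ B.id-IsIso (B.idₑ-IsIso (CartLift.eq ct)))

    comparison = bc (α.η (X o)) (α.η (X o)) B.id B.id (Mono⇒kernelPair (α-mono (X o)))
                    (P o) (sym (e o))
    k = proj₁ comparison
    k-square = proj₁ (proj₂ (proj₂ comparison))
    k-iso = proj₂ (proj₂ (proj₂ comparison))

    φ-mono : E.Mono (φ (Σα₀ o))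
    φ-mono = cart-Mono (φ-cart (Σα₀ o)) (over-Mono (φ-over (Σα₀ o)) (α-mono (X o)))

    u∘ct≈k∘os : g (unit o) E.∘ CartLift.arr ct E.≈ k E.∘ OpcartLift.arr os
    u∘ct≈k∘os = φ-mono _ _ (begin
      φ (Σα₀ o) E.∘ (g (unit o) E.∘ CartLift.arr ct)   ≈⟨ E.≈-sym E.assoc ⟩
      (φ (Σα₀ o) E.∘ g (unit o)) E.∘ CartLift.arr ct   ≈⟨ unit-φ o E.⟩∘⟨refl ⟩
      ψ o E.∘ CartLift.arr ct                          ≈⟨ E.≈-sym k-square ⟩
      φ (Σα₀ o) E.∘ (k E.∘ OpcartLift.arr os)          ∎)
      where open E.HomReasoning

lemma3p2 : ∀ {oa ℓa ea oe ℓe ee ob ℓb eb}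
             {A : Category oa ℓa ea} {E : Category oe ℓe ee} {B : Category ob ℓb eb}
             (U : Functor E B) (bif : Bifibration U)
             {F G : Functor A B} (α : NatTrans F G) →
             Σ (ΣαAdjunction U bif α) λ D →
               BeckChevalley U bif →
               (∀ X → Category.Mono B (NatTrans.η α X)) →
               FullyFaithful (ΣαAdjunction.Σα D)
lemma3p2 U bif α = Σα⊣α* , λ bc α-mono → unitIso⇒fullyFaithful adjunction (unit-IsIso bc α-mono)
  where open ΣαConstruction U bif α
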